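{- Any colored Young diagram poset without blocking triples is balanced.
   Context: A Young diagram is a finite collection of cells in left-justified rows with weakly decreasing row lengths (English notation), regarded as a poset in which a cell covers the cell immediately to its left and the cell immediately above it (when these exist). A colored poset has each element colored black or white. A blocking triple is a triple $x\lessdot y\lessdot z$ (each a covering relation) with $x,y$ of the same color and $z$ of a different color. The pomax game on a colored finite poset: White and Black alternately remove a maximal element (of the remaining subposet) of their own color; a player who cannot move loses. A position (a remaining set of elements with induced order and coloring) is balanced if (i) every position reachable from it in one move (by either player) is balanced, and (ii) whenever all its removable (here: maximal) elements are of the same color, at least half of its elements have that color. A colored poset is balanced if its pomax game is balanced. -}

module Defs where

open import Data.Nat using (ℕ; zero; suc; _+_; _*_; _≤_; _<_)
open import Data.Nat.Properties using (_≟_)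
open import Data.Product using (_×_; _,_; proj₁; proj₂)
open import Data.Product.Properties using (≡-dec)
open import Data.List using (List; []; _∷_; length; map; concat; upTo; filter; zipWith)
open import Data.List.Membership.Propositional using (_∈_)
open import Data.List.Relation.Unary.All using (All)
open import Data.List.Relation.Unary.Linked using (Linked)
open import Relation.Binary.PropositionalEquality using (_≡_; _≢_; refl)
open import Relation.Nullary using (¬_; Dec; yes; no)
open import Data.Sum using (_⊎_)
open import Relation.Nullary.Decidable using (¬?)

data Color : Set where
  black white : Color

-- A Young diagram is given by its list of row lengths λ = (λ₀, λ₁, …),
-- weakly decreasing and positive.
IsPartition : List ℕ → Set
IsPartition λs = Linked (λ a b → b ≤ a) λs × All (λ a → 0 < a) λs

-- Cells are pairs (row i, column j), 0-indexed, English notation.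
Cell : Set
Cell = ℕ × ℕ

rowLen : List ℕ → ℕ → ℕ
rowLen []       _       = 0
rowLen (r ∷ rs) zero    = r
rowLen (r ∷ rs) (suc i) = rowLen rs i

InDiagram : List ℕ → Cell → Set
InDiagram λs (i , j) = j < rowLen λs i

cells : List ℕ → List Cell
cells λs = concat (zipWith (λ i r → map (λ j → (i , j)) (upTo r)) (upTo (length λs)) λs)

_⋖_ : Cell → Cell → Set
(i , j) ⋖ (i' , j') = (i' ≡ i × j' ≡ suc j) ⊎ (i' ≡ suc i × j' ≡ j)

CoversIn : List ℕ → Cell → Cell → Set
CoversIn λs x y = InDiagram λs x × InDiagram λs y × x ⋖ y

-- The partial order of the Young diagram (reflexive-transitive closure of
-- the covering relation, i.e. the componentwise order on cells).
_≼_ : Cell → Cell → Set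
(i , j) ≼ (i' , j') = i ≤ i' × j ≤ j'

-- A colouring assigns a colour to each cell (values off the diagram are
-- irrelevant).
Coloring : Set
Coloring = Cell → Color

BlockingTriple : List ℕ → Coloring → Cell → Cell → Cell → Set
BlockingTriple λs col x y z =
  CoversIn λs x y × CoversIn λs y z × col x ≡ col y × col z ≢ col y

NoBlockingTriples : List ℕ → Coloring → Set
NoBlockingTriples λs col = ∀ x y z → ¬ BlockingTriple λs col x y z

-- Positions: the remaining set of cells, as a list; the order and colouring
-- are induced from the diagram.
Position : Set
Position = List Cell

Maximal : Position → Cell → Set
Maximal S x = x ∈ S × (∀ y → y ∈ S → x ≼ y → y ≡ x)

_≟c_ : (x y : Cell) → Dec (x ≡ y)
_≟c_ = ≡-dec _≟_ _≟_

_≟col_ : (a b : Color) → Dec (a ≡ b)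
black ≟col black = yes refl
white ≟col white = yes refl
black ≟col white = no (λ ())
white ≟col black = no (λ ())

remove : Cell → Position → Position
remove x S = filter (λ y → ¬? (y ≟c x)) S

count : Coloring → Color → Position → ℕ
count col c S = length (filter (λ y → col y ≟col c) S)

-- Balanced positions, defined by well-founded (inductive) recursion on the
-- game tree: (i) every position reachable in one move (removing any maximal
-- element, by whichever player owns its colour) is balanced, and (ii) if
-- all maximal elements have colour c then at least half of the elements
-- have colour c.
data Balanced (col : Coloring) (S : Position) : Set where
  balanced :
    (∀ x → Maximal S x → Balanced col (remove x S)) →
    (∀ c → (∀ x → Maximal S x → col x ≡ c) → length S ≤ 2 * count col c S) →
    Balanced col S

BalancedDiagram : List ℕ → Coloring → Set
BalancedDiagram λs col = Balanced col (cells λs)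

-- A move of the pomax game on a Young diagram removes a corner, so every position reachable from
-- λ is the diagram of a shape μ ⊆ λ, and it suffices to check the counting condition for such μ.
-- Suppose every corner of μ has colour c. If two cells x ⋖ y of μ had the same colour, then, for
-- lack of blocking triples, every cover of y has that colour too; following covers we reach a
-- corner, so that colour is c. Hence no two adjacent cells of μ have the opposite colour. Along a
-- row this leaves at most one more cell of the opposite colour than of colour c, and only if the
-- row starts and ends with the opposite colour. Such a row does not end in a corner, so the next
-- row has the same length; its first and last cells lie below cells of the opposite colour, so
-- they have colour c, and that row has more cells of colour c than of the other colour. Pairing
-- these rows gives at least as many cells of colour c as of the other colour.

module Submission where

open import Defs
open import Data.Empty using (⊥-elim)
open import Data.List using (List; []; _∷_; [_]; _++_; _∷ʳ_; length; map; filter; concat; zipWith; applyUpTo; upTo)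
open import Data.List.Properties
  using (filter-++; filter-accept; filter-reject; length-++; map-++; map-∘; map-upTo; upTo-∷ʳ; ++-identityʳ)
open import Data.List.Membership.Propositional using (_∈_; _∉_)
open import Data.List.Membership.Propositional.Properties
  using (∈-map⁺; ∈-map⁻; ∈-++⁺ˡ; ∈-++⁺ʳ; ∈-++⁻; ∈-upTo⁺; ∈-upTo⁻)
open import Data.List.Relation.Unary.Any using (here; there)
open import Data.List.Relation.Unary.Linked using (Linked; []; [-]; _∷_)
open import Data.Nat using (ℕ; zero; suc; pred; _+_; _*_; _≤_; _<_; _≤′_; ≤′-refl; ≤′-step; z≤n; s≤s; _<?_)
open import Data.Nat.Induction using (<-wellFounded)
open import Data.Nat.ListAction using (sum)
open import Data.Nat.Properties
open import Data.Product using (_×_; _,_; proj₁; proj₂; ∃-syntax)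
open import Data.Sum using (_⊎_; inj₁; inj₂; [_,_]′)
open import Function using (_∘_; _on_)
open import Function.Definitions using (Injective)
open import Induction.WellFounded using (Acc; acc)
open import Relation.Binary.Construct.On using (wellFounded)
open import Relation.Binary.PropositionalEquality hiding ([_])
open import Relation.Nullary using (¬_; yes; no)
open import Relation.Nullary.Decidable using (¬?)

variable
  κ : Coloring
  a c : Color
  x : Cell
  μ : List ℕ
  i j : ℕ

-- Colours and counts

opposite : Color → Color
opposite black = white
opposite white = black

opposite-≢ : ∀ c → opposite c ≢ c
opposite-≢ black ()
opposite-≢ white ()

≡-or-≡opposite : ∀ a c → a ≡ c ⊎ a ≡ opposite c
≡-or-≡opposite black black = inj₁ refl
≡-or-≡opposite black white = inj₂ refl
≡-or-≡opposite white black = inj₂ refl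
≡-or-≡opposite white white = inj₁ refl

≢opposite⇒≡ : a ≢ opposite c → a ≡ c
≢opposite⇒≡ {a} {c} ne = [ (λ e → e) , (λ e → ⊥-elim (ne e)) ]′ (≡-or-≡opposite a c)

≡⇒≢opposite : a ≡ c → a ≢ opposite c
≡⇒≢opposite {c = c} e e' = opposite-≢ c (trans (sym e') e)

count-++ : ∀ xs ys → count κ c (xs ++ ys) ≡ count κ c xs + count κ c ys
count-++ {κ} {c} xs ys = trans (cong length (filter-++ (λ y → κ y ≟col c) xs ys)) (length-++ (filter _ xs))

count-map : ∀ (f : Cell → Cell) xs → count κ c (map f xs) ≡ count (κ ∘ f) c xs
count-map f [] = refl
count-map {κ} {c} f (x ∷ xs) with κ (f x) ≟col c
... | yes _ = cong suc (count-map f xs)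
... | no _  = count-map f xs

count-[x]-≡ : κ x ≡ c → count κ c [ x ] ≡ 1
count-[x]-≡ {κ} {c = c} e = cong length (filter-accept (λ y → κ y ≟col c) e)

length≡count+count-opposite : ∀ κ c xs → length xs ≡ count κ c xs + count κ (opposite c) xs
length≡count+count-opposite κ c [] = refl
length≡count+count-opposite κ c (x ∷ xs) with κ x ≟col c | κ x ≟col opposite c
... | yes _ | no _   = cong suc (length≡count+count-opposite κ c xs)
... | no _  | yes _  = trans (cong suc (length≡count+count-opposite κ c xs)) (sym (+-suc _ _))
... | yes e | yes e' = ⊥-elim (≡⇒≢opposite e e')
... | no ne | no ne' = ⊥-elim ([ ne , ne' ]′ (≡-or-≡opposite (κ x) c))

-- Runs of cells

NoTwoInARow : Coloring → Color → (ℕ → Cell) → ℕ → Set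
NoTwoInARow κ a g n = ∀ j → j < n → ¬ (κ (g j) ≡ a × κ (g (suc j)) ≡ a)

NoTwoInARow-tail : ∀ κ a g {n} → NoTwoInARow κ a g (suc n) → NoTwoInARow κ a (g ∘ suc) n
NoTwoInARow-tail _ _ _ noTwo j j<n = noTwo (suc j) (s≤s j<n)

module _ (κ : Coloring) (c : Color) where

  private
    C D : List Cell → ℕ
    C = count κ c
    D = count κ (opposite c)

  run-count : ∀ (g : ℕ → Cell) n → NoTwoInARow κ (opposite c) g n →
    C [ g 0 ] + C [ g n ] + D (applyUpTo g (suc n)) ≤ suc (C (applyUpTo g (suc n)))
  run-count g zero _ with κ (g 0) ≟col c | κ (g 0) ≟col opposite c
  ... | yes _ | no _    = ≤-refl
  ... | no _  | yes _   = ≤-refl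
  ... | yes e | yes e'  = ⊥-elim (≡⇒≢opposite e e')
  ... | no ne | no ne'  = ⊥-elim (ne (≢opposite⇒≡ ne'))
  run-count g (suc n) noTwo with κ (g 0) ≟col c | κ (g 0) ≟col opposite c
  ... | yes _ | no _ = s≤s (≤-trans (+-monoˡ-≤ _ (m≤n+m _ (C [ g 1 ])))
                                      (run-count (g ∘ suc) n (NoTwoInARow-tail κ (opposite c) g noTwo)))
  ... | no _  | yes e = begin
      C [ g (suc n) ] + suc (D rest)
        ≡⟨ +-suc _ _ ⟩
      suc (C [ g (suc n) ] + D rest)
        ≡⟨ cong (λ k → k + C [ g (suc n) ] + D rest) (sym (count-[x]-≡ {κ} second-c)) ⟩
      C [ g 1 ] + C [ g (suc n) ] + D rest
        ≤⟨ run-count (g ∘ suc) n (NoTwoInARow-tail κ (opposite c) g noTwo) ⟩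
      suc (C rest) ∎
    where
    open ≤-Reasoning
    rest = applyUpTo (g ∘ suc) (suc n)
    second-c : κ (g 1) ≡ c
    second-c = ≢opposite⇒≡ (λ e' → noTwo 0 (s≤s z≤n) (e , e'))
  ... | yes e | yes e'  = ⊥-elim (≡⇒≢opposite e e')
  ... | no ne | no ne'  = ⊥-elim (ne (≢opposite⇒≡ ne'))

  private
    run-count-from-ends : ∀ g n {k} → NoTwoInARow κ (opposite c) g n → k ≤ C [ g 0 ] + C [ g n ] →
      k + D (applyUpTo g (suc n)) ≤ suc (C (applyUpTo g (suc n)))
    run-count-from-ends g n noTwo k≤ends = ≤-trans (+-monoˡ-≤ _ k≤ends) (run-count g n noTwo)

  run-count-≤ : ∀ g n → NoTwoInARow κ (opposite c) g n → κ (g 0) ≡ c ⊎ κ (g n) ≡ c →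
    D (applyUpTo g (suc n)) ≤ C (applyUpTo g (suc n))
  run-count-≤ g n noTwo (inj₁ e) = ≤-pred (run-count-from-ends g n noTwo
    (≤-trans (≤-reflexive (sym (count-[x]-≡ {κ} e))) (m≤m+n _ (C [ g n ]))))
  run-count-≤ g n noTwo (inj₂ e) = ≤-pred (run-count-from-ends g n noTwo
    (≤-trans (≤-reflexive (sym (count-[x]-≡ {κ} e))) (m≤n+m _ (C [ g 0 ]))))

  run-count-< : ∀ g n → NoTwoInARow κ (opposite c) g n → κ (g 0) ≡ c → κ (g n) ≡ c →
    D (applyUpTo g (suc n)) < C (applyUpTo g (suc n))
  run-count-< g n noTwo e₀ eₙ = ≤-pred (run-count-from-ends g n noTwo
    (≤-reflexive (sym (cong₂ _+_ (count-[x]-≡ {κ} e₀) (count-[x]-≡ {κ} eₙ)))))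

  run-count-≤suc : ∀ g n → NoTwoInARow κ (opposite c) g n →
    D (applyUpTo g (suc n)) ≤ suc (C (applyUpTo g (suc n)))
  run-count-≤suc g n noTwo = run-count-from-ends g n {0} noTwo z≤n

-- Shapes

-- Shapes reached during the game may end in rows of length 0, so they are described by an
-- antitone rowLen rather than by IsPartition.
Decreasing : List ℕ → Set
Decreasing μ = ∀ i → rowLen μ (suc i) ≤ rowLen μ i

linked⇒decreasing : Linked (λ a b → b ≤ a) μ → Decreasing μ
linked⇒decreasing []           _       = z≤n
linked⇒decreasing [-]          _       = z≤n
linked⇒decreasing (r≥r' ∷ _)   zero    = r≥r'
linked⇒decreasing (_ ∷ linked) (suc i) = linked⇒decreasing linked i

rowLen-antitone : Decreasing μ → i ≤ j → rowLen μ j ≤ rowLen μ i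
rowLen-antitone {μ} dec = antitone′ ∘ ≤⇒≤′
  where
  antitone′ : ∀ {i j} → i ≤′ j → rowLen μ j ≤ rowLen μ i
  antitone′ ≤′-refl      = ≤-refl
  antitone′ (≤′-step i≤j) = ≤-trans (dec _) (antitone′ i≤j)

_⊑_ : List ℕ → List ℕ → Set
μ ⊑ ν = ∀ i → rowLen μ i ≤ rowLen ν i

InDiagram-⊑ : ∀ {μ ν x} → μ ⊑ ν → InDiagram μ x → InDiagram ν x
InDiagram-⊑ {x = i , _} μ⊑ν = λ j<μᵢ → <-≤-trans j<μᵢ (μ⊑ν i)

Corner : List ℕ → Cell → Set
Corner μ (i , j) = rowLen μ i ≡ suc j × rowLen μ (suc i) ≤ j

shrinkRow : ℕ → List ℕ → List ℕ
shrinkRow _       []       = []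
shrinkRow zero    (r ∷ rs) = pred r ∷ rs
shrinkRow (suc i) (r ∷ rs) = r ∷ shrinkRow i rs

rowLen-shrinkRow-≡ : ∀ μ i → rowLen (shrinkRow i μ) i ≡ pred (rowLen μ i)
rowLen-shrinkRow-≡ []       _       = refl
rowLen-shrinkRow-≡ (r ∷ rs) zero    = refl
rowLen-shrinkRow-≡ (r ∷ rs) (suc i) = rowLen-shrinkRow-≡ rs i

rowLen-shrinkRow-≢ : ∀ μ {i s} → s ≢ i → rowLen (shrinkRow i μ) s ≡ rowLen μ s
rowLen-shrinkRow-≢ []       _                    = refl
rowLen-shrinkRow-≢ (r ∷ rs) {zero}  {zero}  s≢i = ⊥-elim (s≢i refl)
rowLen-shrinkRow-≢ (r ∷ rs) {zero}  {suc s} _   = refl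
rowLen-shrinkRow-≢ (r ∷ rs) {suc i} {zero}  _   = refl
rowLen-shrinkRow-≢ (r ∷ rs) {suc i} {suc s} s≢i = rowLen-shrinkRow-≢ rs (s≢i ∘ cong suc)

shrinkRow-⊑ : ∀ μ i → shrinkRow i μ ⊑ μ
shrinkRow-⊑ μ i s with s ≟ i
... | yes refl = ≤-trans (≤-reflexive (rowLen-shrinkRow-≡ μ i)) pred[n]≤n
... | no s≢i   = ≤-reflexive (rowLen-shrinkRow-≢ μ s≢i)

shrinkRow-decreasing : Decreasing μ → Corner μ (i , j) → Decreasing (shrinkRow i μ)
shrinkRow-decreasing {μ} {i} {j} dec (μᵢ≡1+j , μᵢ₊₁≤j) s with s ≟ i
... | yes refl = begin
  rowLen (shrinkRow i μ) (suc i) ≡⟨ rowLen-shrinkRow-≢ μ 1+n≢n ⟩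
  rowLen μ (suc i)               ≤⟨ μᵢ₊₁≤j ⟩
  j                              ≡⟨ cong pred (sym μᵢ≡1+j) ⟩
  pred (rowLen μ i)              ≡⟨ sym (rowLen-shrinkRow-≡ μ i) ⟩
  rowLen (shrinkRow i μ) i       ∎
  where open ≤-Reasoning
... | no s≢i = begin
  rowLen (shrinkRow i μ) (suc s) ≤⟨ shrinkRow-⊑ μ i (suc s) ⟩
  rowLen μ (suc s)               ≤⟨ dec s ⟩
  rowLen μ s                     ≡⟨ sym (rowLen-shrinkRow-≢ μ s≢i) ⟩
  rowLen (shrinkRow i μ) s       ∎
  where open ≤-Reasoning

sum-shrinkRow : ∀ μ {i j} → rowLen μ i ≡ suc j → sum (shrinkRow i μ) < sum μ
sum-shrinkRow (r ∷ rs) {zero}  refl = ≤-refl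
sum-shrinkRow (r ∷ rs) {suc i} e    = +-monoʳ-< r (sum-shrinkRow rs e)

-- The cells of a shape

rowCells : ℕ → ℕ → List Cell
rowCells i r = map (λ j → (i , j)) (upTo r)

below : Cell → Cell
below (i , j) = (suc i , j)

below-injective : Injective _≡_ _≡_ below
below-injective {_ , _} {_ , _} refl = refl

cells-∷ : ∀ r rs → cells (r ∷ rs) ≡ rowCells 0 r ++ map below (cells rs)
cells-∷ r rs = cong (rowCells 0 r ++_) (begin
  concat (zipWith rowCells (applyUpTo suc (length rs)) rs)
    ≡⟨ cong (λ is → concat (zipWith rowCells is rs)) (sym (map-upTo suc (length rs))) ⟩
  concat (zipWith rowCells (map suc (upTo (length rs))) rs)
    ≡⟨ shift (upTo (length rs)) rs ⟩
  map below (cells rs) ∎)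
  where
  open ≡-Reasoning
  shift : ∀ is rs → concat (zipWith rowCells (map suc is) rs) ≡ map below (concat (zipWith rowCells is rs))
  shift []       _        = refl
  shift (_ ∷ _)  []       = refl
  shift (i ∷ is) (r ∷ rs) = begin
    rowCells (suc i) r ++ concat (zipWith rowCells (map suc is) rs)
      ≡⟨ cong₂ _++_ (map-∘ (upTo r)) (shift is rs) ⟩
    map below (rowCells i r) ++ map below (concat (zipWith rowCells is rs))
      ≡⟨ sym (map-++ below (rowCells i r) _) ⟩
    map below (rowCells i r ++ concat (zipWith rowCells is rs)) ∎

∈-cells⁺ : ∀ μ {x} → InDiagram μ x → x ∈ cells μ
∈-cells⁺ (r ∷ rs) {zero , j}  j<r =
  subst (_ ∈_) (sym (cells-∷ r rs)) (∈-++⁺ˡ (∈-map⁺ (0 ,_) (∈-upTo⁺ j<r)))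
∈-cells⁺ (r ∷ rs) {suc i , j} p   =
  subst (_ ∈_) (sym (cells-∷ r rs)) (∈-++⁺ʳ (rowCells 0 r) (∈-map⁺ below (∈-cells⁺ rs p)))

∈-cells⁻ : ∀ μ {x} → x ∈ cells μ → InDiagram μ x
∈-cells⁻ (r ∷ rs) x∈ with ∈-++⁻ (rowCells 0 r) (subst (_ ∈_) (cells-∷ r rs) x∈)
... | inj₁ x∈row   with _ , j∈ , refl ← ∈-map⁻ (0 ,_) x∈row = ∈-upTo⁻ j∈
... | inj₂ x∈below with (_ , _) , y∈ , refl ← ∈-map⁻ below x∈below = ∈-cells⁻ rs y∈

remove-++ : ∀ x xs ys → remove x (xs ++ ys) ≡ remove x xs ++ remove x ys
remove-++ x = filter-++ (λ y → ¬? (y ≟c x))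

remove-∉ : ∀ {x xs} → x ∉ xs → remove x xs ≡ xs
remove-∉ {xs = []}    _  = refl
remove-∉ {x} {y ∷ xs} x∉ = trans
  (filter-accept (λ z → ¬? (z ≟c x)) (λ y≡x → x∉ (here (sym y≡x))))
  (cong (y ∷_) (remove-∉ (x∉ ∘ there)))

remove-map : ∀ {f : Cell → Cell} → Injective _≡_ _≡_ f →
  ∀ x xs → remove (f x) (map f xs) ≡ map f (remove x xs)
remove-map         f-inj x []       = refl
remove-map {f = f} f-inj x (y ∷ xs) with y ≟c x | f y ≟c f x
... | yes _   | yes _     = remove-map f-inj x xs
... | no _    | no _      = cong (f y ∷_) (remove-map f-inj x xs)
... | yes y≡x | no fy≢fx  = ⊥-elim (fy≢fx (cong f y≡x))
... | no y≢x  | yes fy≡fx = ⊥-elim (y≢x (f-inj fy≡fx))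

remove-last-of-row : ∀ i j → remove (i , j) (rowCells i (suc j)) ≡ rowCells i j
remove-last-of-row i j = begin
  remove (i , j) (rowCells i (suc j))
    ≡⟨ cong (remove (i , j) ∘ map (i ,_)) (sym (upTo-∷ʳ j)) ⟩
  remove (i , j) (map (i ,_) (upTo j ∷ʳ j))
    ≡⟨ cong (remove (i , j)) (map-++ (i ,_) (upTo j) [ j ]) ⟩
  remove (i , j) (rowCells i j ++ [ (i , j) ])
    ≡⟨ remove-++ (i , j) (rowCells i j) [ (i , j) ] ⟩
  remove (i , j) (rowCells i j) ++ remove (i , j) [ (i , j) ]
    ≡⟨ cong₂ _++_ (remove-∉ i,j∉) (filter-reject (λ z → ¬? (z ≟c (i , j))) (λ ne → ne refl)) ⟩
  rowCells i j ++ []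
    ≡⟨ ++-identityʳ (rowCells i j) ⟩
  rowCells i j ∎
  where
  open ≡-Reasoning
  i,j∉ : (i , j) ∉ rowCells i j
  i,j∉ p with _ , j∈ , refl ← ∈-map⁻ (i ,_) p = <-irrefl refl (∈-upTo⁻ j∈)

remove-corner : ∀ μ {i j} → rowLen μ i ≡ suc j → remove (i , j) (cells μ) ≡ cells (shrinkRow i μ)
remove-corner (r ∷ rs) {zero} {j} refl = begin
  remove (0 , j) (cells (suc j ∷ rs))
    ≡⟨ cong (remove (0 , j)) (cells-∷ (suc j) rs) ⟩
  remove (0 , j) (rowCells 0 (suc j) ++ map below (cells rs))
    ≡⟨ remove-++ (0 , j) (rowCells 0 (suc j)) _ ⟩
  remove (0 , j) (rowCells 0 (suc j)) ++ remove (0 , j) (map below (cells rs))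
    ≡⟨ cong₂ _++_ (remove-last-of-row 0 j) (remove-∉ 0,j∉) ⟩
  rowCells 0 j ++ map below (cells rs)
    ≡⟨ sym (cells-∷ j rs) ⟩
  cells (j ∷ rs) ∎
  where
  open ≡-Reasoning
  0,j∉ : (0 , j) ∉ map below (cells rs)
  0,j∉ p with (_ , _) , _ , () ← ∈-map⁻ below p
remove-corner (r ∷ rs) {suc i} {j} e = begin
  remove (suc i , j) (cells (r ∷ rs))
    ≡⟨ cong (remove (suc i , j)) (cells-∷ r rs) ⟩
  remove (suc i , j) (rowCells 0 r ++ map below (cells rs))
    ≡⟨ remove-++ (suc i , j) (rowCells 0 r) _ ⟩
  remove (suc i , j) (rowCells 0 r) ++ remove (below (i , j)) (map below (cells rs))
    ≡⟨ cong₂ _++_ (remove-∉ 1+i,j∉) (remove-map below-injective (i , j) (cells rs)) ⟩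
  rowCells 0 r ++ map below (remove (i , j) (cells rs))
    ≡⟨ cong (λ S → rowCells 0 r ++ map below S) (remove-corner rs e) ⟩
  rowCells 0 r ++ map below (cells (shrinkRow i rs))
    ≡⟨ sym (cells-∷ r (shrinkRow i rs)) ⟩
  cells (r ∷ shrinkRow i rs) ∎
  where
  open ≡-Reasoning
  1+i,j∉ : (suc i , j) ∉ rowCells 0 r
  1+i,j∉ p with _ , _ , () ← ∈-map⁻ (0 ,_) p

-- Maximal cells

maximal⇒corner : ∀ μ {x} → Maximal (cells μ) x → Corner μ x
maximal⇒corner μ {i , j} (x∈ , top) = μᵢ≡1+j , μᵢ₊₁≤j
  where
  μᵢ≡1+j : rowLen μ i ≡ suc j
  μᵢ≡1+j = ≤-antisym
    (≮⇒≥ λ 1+j<μᵢ → 1+n≢n (cong proj₂ (top (i , suc j) (∈-cells⁺ μ 1+j<μᵢ) (≤-refl , n≤1+n j))))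
    (∈-cells⁻ μ x∈)
  μᵢ₊₁≤j : rowLen μ (suc i) ≤ j
  μᵢ₊₁≤j = ≮⇒≥ λ j<μᵢ₊₁ →
    1+n≢n (cong proj₁ (top (suc i , j) (∈-cells⁺ μ j<μᵢ₊₁) (n≤1+n i , ≤-refl)))

corner⇒maximal : ∀ μ {x} → Decreasing μ → Corner μ x → Maximal (cells μ) x
corner⇒maximal μ {i , j} dec (μᵢ≡1+j , μᵢ₊₁≤j) = ∈-cells⁺ μ (≤-reflexive (sym μᵢ≡1+j)) , top
  where
  top : ∀ y → y ∈ cells μ → (i , j) ≼ y → y ≡ (i , j)
  top (i' , j') y∈ (i≤i' , j≤j') with m≤n⇒m<n∨m≡n i≤i'
  ... | inj₁ i<i' = ⊥-elim (<-irrefl refl (begin-strict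
    j'               <⟨ ∈-cells⁻ μ y∈ ⟩
    rowLen μ i'      ≤⟨ rowLen-antitone {μ} dec i<i' ⟩
    rowLen μ (suc i) ≤⟨ μᵢ₊₁≤j ⟩
    j                ≤⟨ j≤j' ⟩
    j'               ∎))
    where open ≤-Reasoning
  ... | inj₂ refl = cong (i ,_) (≤-antisym (≤-pred (subst (j' <_) μᵢ≡1+j (∈-cells⁻ μ y∈))) j≤j')

corner-or-cover : ∀ μ {x} → InDiagram μ x → Corner μ x ⊎ ∃[ y ] (InDiagram μ y × x ⋖ y)
corner-or-cover μ {i , j} j<μᵢ with suc j <? rowLen μ i | j <? rowLen μ (suc i)
... | yes right | _        = inj₂ ((i , suc j) , right , inj₁ (refl , refl))
... | no _      | yes down = inj₂ ((suc i , j) , down , inj₂ (refl , refl))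
... | no ¬right | no ¬down = inj₁ (≤-antisym (≮⇒≥ ¬right) j<μᵢ , ≮⇒≥ ¬down)

ascend : ∀ {A : Set} {P Q : A → Set} (height : A → ℕ) (bound : ℕ) →
  (∀ {a} → P a → height a < bound) →
  (∀ {a} → P a → Q a ⊎ ∃[ b ] (P b × height a < height b)) →
  ∀ {a} → P a → ∃[ b ] (P b × Q b)
ascend {P = P} {Q} height bound bounded step {a} pa = go bound (m≤m+n bound (height a)) pa
  where
  go : ∀ fuel {a} → bound ≤ fuel + height a → P a → ∃[ b ] (P b × Q b)
  go zero       bound≤ pa = ⊥-elim (<⇒≱ (bounded pa) bound≤)
  go (suc fuel) {a} bound≤ pa with step pa
  ... | inj₁ qa            = a , pa , qa
  ... | inj₂ (b , pb , a<b) = go fuel (≤-trans bound≤ (begin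
    suc fuel + height a   ≡⟨ sym (+-suc fuel (height a)) ⟩
    fuel + suc (height a) ≤⟨ +-monoʳ-≤ fuel a<b ⟩
    fuel + height b       ∎)) pb
    where open ≤-Reasoning

height : Cell → ℕ
height (i , j) = i + j

⋖-height : ∀ {x y} → x ⋖ y → height x < height y
⋖-height {i , j} (inj₁ (refl , refl)) = ≤-reflexive (sym (+-suc i j))
⋖-height {i , j} (inj₂ (refl , refl)) = ≤-refl

height-bound : ∀ μ {x} → InDiagram μ x → height x < length μ + sum μ
height-bound (r ∷ rs) {zero , j}  j<r = <-≤-trans j<r (≤-trans (m≤m+n r (sum rs)) (m≤n+m _ (length (r ∷ rs))))
height-bound (r ∷ rs) {suc i , j} p   =
  s≤s (<-≤-trans (height-bound rs p) (+-monoʳ-≤ (length rs) (m≤n+m (sum rs) r)))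

colour-propagates : ∀ {λs κ x y z} → NoBlockingTriples λs κ →
  CoversIn λs x y → CoversIn λs y z → κ x ≡ κ y → κ z ≡ κ y
colour-propagates {κ = κ} {x} {y} {z} noBlocking x⋖y y⋖z κx≡κy with κ z ≟col κ y
... | yes κz≡κy = κz≡κy
... | no  κz≢κy = ⊥-elim (noBlocking x y z (x⋖y , y⋖z , κx≡κy , κz≢κy))

-- Without blocking triples a covering pair of equal colours passes its colour on to every cover
-- of the upper cell; climb along covers until a corner is reached.
same-colour-cover⇒maximal : ∀ {λs μ κ} → NoBlockingTriples λs κ → Decreasing μ → μ ⊑ λs →
  ∀ {x y} → InDiagram μ x → InDiagram μ y → x ⋖ y → κ x ≡ κ y → ∃[ m ] (Maximal (cells μ) m × κ m ≡ κ y)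
same-colour-cover⇒maximal {λs} {μ} {κ} noBlocking dec μ⊑λ {x} {y} x∈ y∈ x⋖y κx≡κy =
  maximal-in-colour (climb (y∈ , refl , x , x∈ , x⋖y , κx≡κy))
  where
  lift : ∀ {z} → InDiagram μ z → InDiagram λs z
  lift {z} = InDiagram-⊑ {μ} {λs} {z} μ⊑λ

  ReachedInColour : Cell → Set
  ReachedInColour z = InDiagram μ z × κ z ≡ κ y × ∃[ w ] (InDiagram μ w × w ⋖ z × κ w ≡ κ y)

  step : ∀ {z} → ReachedInColour z → Maximal (cells μ) z ⊎ ∃[ z' ] (ReachedInColour z' × height z < height z')
  step {z} (z∈ , κz≡ , w , w∈ , w⋖z , κw≡) with corner-or-cover μ z∈
  ... | inj₁ corner             = inj₁ (corner⇒maximal μ dec corner)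
  ... | inj₂ (z' , z'∈ , z⋖z') = inj₂ (z' , (z'∈ , κz'≡ , z , z∈ , z⋖z' , κz≡) , ⋖-height z⋖z')
    where
    κz'≡ : κ z' ≡ κ y
    κz'≡ = trans (colour-propagates {λs} {κ} {w} {z} {z'} noBlocking
                   (lift w∈ , lift z∈ , w⋖z) (lift z∈ , lift z'∈ , z⋖z') (trans κw≡ (sym κz≡)))
                 κz≡

  climb : ∀ {z} → ReachedInColour z → ∃[ m ] (ReachedInColour m × Maximal (cells μ) m)
  climb = ascend height (length μ + sum μ) (λ p → height-bound μ (proj₁ p)) step

  maximal-in-colour : ∃[ m ] (ReachedInColour m × Maximal (cells μ) m) → ∃[ m ] (Maximal (cells μ) m × κ m ≡ κ y)
  maximal-in-colour (m , (_ , κm≡κy , _) , m-max) = m , m-max , κm≡κy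

-- Counting on a shape

record Scattered (μ : List ℕ) (κ : Coloring) (a : Color) : Set where
  field
    decreasing    : Decreasing μ
    no-adjacent   : ∀ x y → InDiagram μ x → InDiagram μ y → x ⋖ y → ¬ (κ x ≡ a × κ y ≡ a)
    corners-avoid : ∀ x → Corner μ x → κ x ≢ a

⋖-below : ∀ {x y} → x ⋖ y → below x ⋖ below y
⋖-below {_ , _} {_ , _} (inj₁ (refl , refl)) = inj₁ (refl , refl)
⋖-below {_ , _} {_ , _} (inj₂ (refl , refl)) = inj₂ (refl , refl)

module _ {μ : List ℕ} {κ : Coloring} {a : Color} (scattered : Scattered μ κ a) where
  open Scattered scattered

  Scattered⇒NoTwoInARow : ∀ {i m} → m < rowLen μ i → NoTwoInARow κ a (i ,_) m
  Scattered⇒NoTwoInARow {i} m<μᵢ j j<m =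
    no-adjacent (i , j) (i , suc j) (<-trans j<m m<μᵢ) (≤-<-trans j<m m<μᵢ) (inj₁ (refl , refl))

  next-row-as-long : ∀ {i m} → rowLen μ i ≡ suc m → κ (i , m) ≡ a → rowLen μ (suc i) ≡ suc m
  next-row-as-long {i} {m} μᵢ≡1+m κ≡a = ≤-antisym
    (≤-trans (decreasing i) (≤-reflexive μᵢ≡1+m))
    (≰⇒> λ μᵢ₊₁≤m → corners-avoid (i , m) (μᵢ≡1+m , μᵢ₊₁≤m) κ≡a)

Scattered-below : ∀ {r rs κ a} → Scattered (r ∷ rs) κ a → Scattered rs (κ ∘ below) a
Scattered-below scattered = record
  { decreasing    = decreasing ∘ suc
  ; no-adjacent   = λ { (i , j) (i' , j') x∈ y∈ x⋖y → no-adjacent (suc i , j) (suc i' , j') x∈ y∈ (⋖-below x⋖y) }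
  ; corners-avoid = λ { (i , j) → corners-avoid (suc i , j) }
  }
  where open Scattered scattered

count-cells-∷ : ∀ κ a r rs →
  count κ a (cells (r ∷ rs)) ≡ count κ a (applyUpTo (0 ,_) r) + count (κ ∘ below) a (cells rs)
count-cells-∷ κ a r rs = begin
  count κ a (cells (r ∷ rs))                                      ≡⟨ cong (count κ a) (cells-∷ r rs) ⟩
  count κ a (rowCells 0 r ++ map below (cells rs))                ≡⟨ count-++ (rowCells 0 r) _ ⟩
  count κ a (rowCells 0 r) + count κ a (map below (cells rs))     ≡⟨ cong₂ _+_ (cong (count κ a) (map-upTo (0 ,_) r))
                                                                                 (count-map below (cells rs)) ⟩
  count κ a (applyUpTo (0 ,_) r) + count (κ ∘ below) a (cells rs) ∎
  where open ≡-Reasoning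

module _ {κ : Coloring} {a b : Color} where

  count-≤-by-first-row : ∀ r rs →
    count κ a (applyUpTo (0 ,_) r) ≤ count κ b (applyUpTo (0 ,_) r) →
    count (κ ∘ below) a (cells rs) ≤ count (κ ∘ below) b (cells rs) →
    count κ a (cells (r ∷ rs)) ≤ count κ b (cells (r ∷ rs))
  count-≤-by-first-row r rs row rest =
    subst₂ _≤_ (sym (count-cells-∷ κ a r rs)) (sym (count-cells-∷ κ b r rs)) (+-mono-≤ row rest)

  count-≤-by-first-two-rows : ∀ r rs →
    count κ a (applyUpTo (0 ,_) r) ≤ suc (count κ b (applyUpTo (0 ,_) r)) →
    count (κ ∘ below) a (applyUpTo (0 ,_) r) < count (κ ∘ below) b (applyUpTo (0 ,_) r) →
    count (κ ∘ below ∘ below) a (cells rs) ≤ count (κ ∘ below ∘ below) b (cells rs) →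
    count κ a (cells (r ∷ r ∷ rs)) ≤ count κ b (cells (r ∷ r ∷ rs))
  count-≤-by-first-two-rows r rs row₀ row₁ rest = subst₂ _≤_ (sym (two-rows a)) (sym (two-rows b)) (begin
    D₀ + (D₁ + D)     ≤⟨ +-monoˡ-≤ _ row₀ ⟩
    suc C₀ + (D₁ + D) ≡⟨ sym (+-suc C₀ _) ⟩
    C₀ + (suc D₁ + D) ≤⟨ +-monoʳ-≤ C₀ (+-mono-≤ row₁ rest) ⟩
    C₀ + (C₁ + C)     ∎)
    where
    open ≤-Reasoning
    D₀ = count κ a (applyUpTo (0 ,_) r)
    C₀ = count κ b (applyUpTo (0 ,_) r)
    D₁ = count (κ ∘ below) a (applyUpTo (0 ,_) r)
    C₁ = count (κ ∘ below) b (applyUpTo (0 ,_) r)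
    D  = count (κ ∘ below ∘ below) a (cells rs)
    C  = count (κ ∘ below ∘ below) b (cells rs)
    two-rows : ∀ e → count κ e (cells (r ∷ r ∷ rs)) ≡
      count κ e (applyUpTo (0 ,_) r) + (count (κ ∘ below) e (applyUpTo (0 ,_) r) + count (κ ∘ below ∘ below) e (cells rs))
    two-rows e = trans (count-cells-∷ κ e r (r ∷ rs)) (cong (_ +_) (count-cells-∷ (κ ∘ below) e r rs))

count-opposite≤count : ∀ μ κ c → Scattered μ κ (opposite c) → count κ (opposite c) (cells μ) ≤ count κ c (cells μ)

-- The first row has at most one surplus cell of the opposite colour; the second row, as long and
-- with both ends of colour c, has a deficit of at least one.
count-opposite≤count-from-doubly-opposite-row : ∀ m rs κ c → Scattered (suc m ∷ rs) κ (opposite c) →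
  κ (0 , 0) ≡ opposite c → κ (0 , m) ≡ opposite c → rowLen rs 0 ≡ suc m →
  count κ (opposite c) (cells (suc m ∷ rs)) ≤ count κ c (cells (suc m ∷ rs))

count-opposite≤count []           κ c _         = z≤n
count-opposite≤count (zero ∷ rs)  κ c scattered =
  count-≤-by-first-row {κ} 0 rs z≤n (count-opposite≤count rs (κ ∘ below) c (Scattered-below scattered))
count-opposite≤count (suc m ∷ rs) κ c scattered
  with ≡-or-≡opposite (κ (0 , 0)) c | ≡-or-≡opposite (κ (0 , m)) c
... | inj₁ e₀ | _       = count-≤-by-first-row {κ} (suc m) rs
  (run-count-≤ κ c (0 ,_) m (Scattered⇒NoTwoInARow scattered ≤-refl) (inj₁ e₀))
  (count-opposite≤count rs (κ ∘ below) c (Scattered-below scattered))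
... | inj₂ _  | inj₁ eₘ = count-≤-by-first-row {κ} (suc m) rs
  (run-count-≤ κ c (0 ,_) m (Scattered⇒NoTwoInARow scattered ≤-refl) (inj₂ eₘ))
  (count-opposite≤count rs (κ ∘ below) c (Scattered-below scattered))
... | inj₂ e₀ | inj₂ eₘ =
  count-opposite≤count-from-doubly-opposite-row m rs κ c scattered e₀ eₘ (next-row-as-long scattered {0} refl eₘ)

count-opposite≤count-from-doubly-opposite-row m (_ ∷ rs) κ c scattered e₀ eₘ refl =
  count-≤-by-first-two-rows {κ} (suc m) rs
  (run-count-≤suc κ c (0 ,_) m (Scattered⇒NoTwoInARow scattered ≤-refl))
  (run-count-< (κ ∘ below) c (0 ,_) m (Scattered⇒NoTwoInARow (Scattered-below scattered) ≤-refl)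
    (below-c (s≤s z≤n) e₀) (below-c ≤-refl eₘ))
  (count-opposite≤count rs (κ ∘ below ∘ below) c (Scattered-below (Scattered-below scattered)))
  where
  below-c : ∀ {j} → j < suc m → κ (0 , j) ≡ opposite c → κ (1 , j) ≡ c
  below-c {j} j<1+m e =
    ≢opposite⇒≡ (λ e' → Scattered.no-adjacent scattered (0 , j) (1 , j) j<1+m j<1+m (inj₂ (refl , refl)) (e , e'))

-- The game

module _ {λs : List ℕ} {κ : Coloring} (noBlocking : NoBlockingTriples λs κ) where

  half-condition : ∀ {μ} → Decreasing μ → μ ⊑ λs → ∀ c → (∀ x → Maximal (cells μ) x → κ x ≡ c) →
    length (cells μ) ≤ 2 * count κ c (cells μ)
  half-condition {μ} dec μ⊑λ c maximal-c = begin
    length (cells μ)                                      ≡⟨ length≡count+count-opposite κ c (cells μ) ⟩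
    count κ c (cells μ) + count κ (opposite c) (cells μ) ≤⟨ +-monoʳ-≤ _ (count-opposite≤count μ κ c scattered) ⟩
    count κ c (cells μ) + count κ c (cells μ)            ≡⟨ cong (count κ c (cells μ) +_) (sym (+-identityʳ _)) ⟩
    2 * count κ c (cells μ)                              ∎
    where
    open ≤-Reasoning
    scattered : Scattered μ κ (opposite c)
    scattered = record
      { decreasing    = dec
      ; no-adjacent   = no-adjacent
      ; corners-avoid = λ x corner → ≡⇒≢opposite (maximal-c x (corner⇒maximal μ dec corner))
      }
      where
      no-adjacent : ∀ x y → InDiagram μ x → InDiagram μ y → x ⋖ y → ¬ (κ x ≡ opposite c × κ y ≡ opposite c)
      no-adjacent x y x∈ y∈ x⋖y (κx , κy)
        with m , m-max , κm≡κy ←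
               same-colour-cover⇒maximal {λs} {μ} noBlocking dec μ⊑λ {x} {y} x∈ y∈ x⋖y (trans κx (sym κy))
        = opposite-≢ c (trans (sym (trans κm≡κy κy)) (maximal-c m m-max))

  balanced-shape : ∀ μ → Acc (_<_ on sum) μ → Decreasing μ → μ ⊑ λs → Balanced κ (cells μ)
  balanced-shape μ (acc smaller) dec μ⊑λ = balanced move (half-condition {μ} dec μ⊑λ)
    where
    move : ∀ x → Maximal (cells μ) x → Balanced κ (remove x (cells μ))
    move (i , j) x-max = subst (Balanced κ) (sym (remove-corner μ μᵢ≡1+j))
      (balanced-shape (shrinkRow i μ) (smaller (sum-shrinkRow μ μᵢ≡1+j)) (shrinkRow-decreasing {μ} {i} dec corner)
                      (λ s → ≤-trans (shrinkRow-⊑ μ i s) (μ⊑λ s)))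
      where
      corner = maximal⇒corner μ x-max
      μᵢ≡1+j = proj₁ corner

mainTheorem7 : (λs : List ℕ) → IsPartition λs → (col : Coloring) →
    NoBlockingTriples λs col → BalancedDiagram λs col
mainTheorem7 λs (linked , _) κ noBlocking =
  balanced-shape {λs} noBlocking λs (wellFounded sum <-wellFounded λs) (linked⇒decreasing linked) (λ _ → ≤-refl)
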